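{- Let $a_1,a_2,a_3,a_4,x_1,x_2,x_3,x_4$ be nonzero complex numbers, $K:=a_1a_2a_3a_4$, and $\mathcal E_0:=(a_1-a_2a_4/a_3)(a_1-a_2a_3/a_4)$. Then for every integer $n\ge0$ (whenever no denominator vanishes) $$\mathcal E_0\sum_{k=0}^{n-1}q^{k-1}\frac{(a_1^2/q,a_2^2/q;q)_k(x_1^2;q^2)_k}{(K/(a_3^2q),K/(a_4^2q);q)_{k+1}(x_1x_3x_4/x_2;q^2)_k}=1-\frac{(a_1^2/q,a_2^2/q;q)_n(x_1^2;q^2)_n}{(K/(a_3^2q),K/(a_4^2q);q)_n(x_1x_3x_4/x_2;q^2)_n}$$ $$-x_1(x_1-x_3x_4/x_2)\sum_{k=0}^{n-1}q^{2k}\frac{(a_1^2/q,a_2^2/q;q)_{k+1}(x_1^2;q^2)_k}{(K/(a_3^2q),K/(a_4^2q);q)_{k+1}(x_1x_3x_4/x_2;q^2)_{k+1}}.$$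
   Context: $q$ is a nonzero complex number with $|q|<1$. For a base $p$ and integer $k\ge0$, $(z;p)_k:=\prod_{j=0}^{k-1}(1-zp^j)$, and $(z_1,\dots,z_m;p)_k:=(z_1;p)_k\cdots(z_m;p)_k$. -}

module Defs where

open import Level using (Level; _⊔_) renaming (suc to lsuc)
open import Data.Nat using (ℕ; zero; suc)
open import Relation.Nullary using (¬_)
open import Algebra.Bundles using (CommutativeRing)

-- A field: a commutative ring with 0 ≠ 1 and a (total) inverse operation
-- that is a genuine multiplicative inverse on every nonzero element
-- (the value of 0⁻¹ is irrelevant, as in Lean/Mathlib).
record Field (c ℓ : Level) : Set (lsuc (c ⊔ ℓ)) where
  field
    commutativeRing : CommutativeRing c ℓ
  open CommutativeRing commutativeRing public
  field
    _⁻¹      : Carrier → Carrier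
    0≉1      : ¬ (0# ≈ 1#)
    inverseʳ : ∀ x → ¬ (x ≈ 0#) → (x * (x ⁻¹)) ≈ 1#

module FieldNotation {c ℓ : Level} (F : Field c ℓ) where
  open Field F

  infixl 7 _÷_
  _÷_ : Carrier → Carrier → Carrier
  a ÷ b = a * (b ⁻¹)

  pow : Carrier → ℕ → Carrier
  pow z zero    = 1#
  pow z (suc k) = pow z k * z

  poch : Carrier → Carrier → ℕ → Carrier
  poch z p zero    = 1#
  poch z p (suc k) = poch z p k * (1# - z * pow p k)

  sumTo : ℕ → (ℕ → Carrier) → Carrier
  sumTo zero    f = 0#
  sumTo (suc n) f = sumTo n f + f n

-- Write T_k = (A,B;q)_k (X;q²)_k / (C,D;q)_k (Y;q²)_k for the ratio subtracted on the right, with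
-- X = x₁², Y = x₁x₃x₄/x₂ and u = q^k.  The k-th summands f₁(k), f₂(k) of the two sums and
-- T_k − T_{k+1} are all multiples of (A,B;q)_k (X;q²)_k / (C,D;q)_{k+1} (Y;q²)_{k+1}, and after
-- dividing by it the relation
--   E₀ f₁(k) + (X − Y) f₂(k) = T_k − T_{k+1}
-- becomes (1 − Cu)(1 − Du) − (1 − Au)(1 − Bu) = E₀ u / q, true because CD = AB and A + B − C − D = E₀ / q.
-- Summing over k < n telescopes to 1 − T_n, and x₁(x₁ − x₃x₄/x₂) = X − Y.
module Submission where

open import Level using (Level)
open import Algebra.Bundles using (CommutativeRing)
open import Algebra.Solver.Ring.AlmostCommutativeRing
  using (_-Raw-AlmostCommutative⟶_) renaming (fromCommutativeRing to toAlmostCommutativeRing)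
import Algebra.Solver.Ring
import Algebra.Properties.Semiring.Mult.TCOptimised
open import Data.Nat as ℕ using (ℕ; zero; suc; _≤_; s≤s)
import Data.Nat.Properties as ℕ
open import Data.Integer as ℤ using (ℤ; +_; -[1+_]; _⊖_)
import Data.Integer.Properties as ℤ
open import Data.Integer.Tactic.RingSolver using (solve-∀)
open import Data.Maybe using (Maybe; just; nothing)
open import Data.Product using (∃₂; _,_)
open import Data.Sum using (inj₁; inj₂)
open import Relation.Nullary using (¬_; yes; no)
open import Relation.Binary.PropositionalEquality as ≡ using (_≡_)
open import Defs

integer-as-difference : ∀ i → ∃₂ λ m n → i ≡ m ⊖ n
integer-as-difference (+ n)    = n , 0 , ≡.sym (ℤ.⊖-≥ ℕ.z≤n)
integer-as-difference -[1+ n ] = 0 , suc n , ≡.refl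

⊖-+-⊖ : ∀ a b c d → (a ⊖ b) ℤ.+ (c ⊖ d) ≡ (a ℕ.+ c) ⊖ (b ℕ.+ d)
⊖-+-⊖ a b c d = begin
  (a ⊖ b) ℤ.+ (c ⊖ d)                 ≡⟨ ≡.cong₂ ℤ._+_ (ℤ.[+m]-[+n]≡m⊖n a b) (ℤ.[+m]-[+n]≡m⊖n c d) ⟨
  (+ a ℤ.- + b) ℤ.+ (+ c ℤ.- + d)     ≡⟨ regroup (+ a) (+ b) (+ c) (+ d) ⟩
  (+ a ℤ.+ + c) ℤ.- (+ b ℤ.+ + d)     ≡⟨ ≡.cong₂ ℤ._-_ (ℤ.pos-+ a c) (ℤ.pos-+ b d) ⟨
  + (a ℕ.+ c) ℤ.- + (b ℕ.+ d)         ≡⟨ ℤ.[+m]-[+n]≡m⊖n (a ℕ.+ c) (b ℕ.+ d) ⟩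
  (a ℕ.+ c) ⊖ (b ℕ.+ d)               ∎
  where
  open ≡.≡-Reasoning
  regroup : ∀ a b c d → (a ℤ.- b) ℤ.+ (c ℤ.- d) ≡ (a ℤ.+ c) ℤ.- (b ℤ.+ d)
  regroup = solve-∀

⊖-*-⊖ : ∀ a b c d → (a ⊖ b) ℤ.* (c ⊖ d) ≡ (a ℕ.* c ℕ.+ b ℕ.* d) ⊖ (a ℕ.* d ℕ.+ b ℕ.* c)
⊖-*-⊖ a b c d = begin
  (a ⊖ b) ℤ.* (c ⊖ d)                                   ≡⟨ ≡.cong₂ ℤ._*_ (ℤ.[+m]-[+n]≡m⊖n a b) (ℤ.[+m]-[+n]≡m⊖n c d) ⟨
  (+ a ℤ.- + b) ℤ.* (+ c ℤ.- + d)                       ≡⟨ expand (+ a) (+ b) (+ c) (+ d) ⟩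
  (+ a ℤ.* + c ℤ.+ + b ℤ.* + d) ℤ.- (+ a ℤ.* + d ℤ.+ + b ℤ.* + c)
    ≡⟨ ≡.cong₂ ℤ._-_ (≡.cong₂ ℤ._+_ (ℤ.pos-* a c) (ℤ.pos-* b d)) (≡.cong₂ ℤ._+_ (ℤ.pos-* a d) (ℤ.pos-* b c)) ⟨
  (+ (a ℕ.* c) ℤ.+ + (b ℕ.* d)) ℤ.- (+ (a ℕ.* d) ℤ.+ + (b ℕ.* c))
    ≡⟨ ≡.cong₂ ℤ._-_ (ℤ.pos-+ (a ℕ.* c) (b ℕ.* d)) (ℤ.pos-+ (a ℕ.* d) (b ℕ.* c)) ⟨
  + (a ℕ.* c ℕ.+ b ℕ.* d) ℤ.- + (a ℕ.* d ℕ.+ b ℕ.* c)   ≡⟨ ℤ.[+m]-[+n]≡m⊖n (a ℕ.* c ℕ.+ b ℕ.* d) (a ℕ.* d ℕ.+ b ℕ.* c) ⟩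
  (a ℕ.* c ℕ.+ b ℕ.* d) ⊖ (a ℕ.* d ℕ.+ b ℕ.* c)         ∎
  where
  open ≡.≡-Reasoning
  expand : ∀ a b c d → (a ℤ.- b) ℤ.* (c ℤ.- d) ≡ (a ℤ.* c ℤ.+ b ℤ.* d) ℤ.- (a ℤ.* d ℤ.+ b ℤ.* c)
  expand = solve-∀

-- The library solvers for an arbitrary commutative ring take their coefficients in the ring itself,
-- where 1# - 1# does not normalise to 0#; coefficients in ℤ, mapped along ℤ → R, do cancel.
module IntegerCoefficients {c ℓ : Level} (R : CommutativeRing c ℓ) where
  open CommutativeRing R
  open Algebra.Properties.Semiring.Mult.TCOptimised semiring using (_×_; ×-homo-+; ×1-homo-*; 1+×)
  open import Relation.Binary.Reasoning.Setoid setoid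
  open import Algebra.Properties.Group +-group using (ε⁻¹≈ε)
  open import Algebra.Properties.AbelianGroup +-abelianGroup using (⁻¹-anti-homo‿-; ⁻¹-∙-comm)
  open import Algebra.Properties.CommutativeSemigroup +-commutativeSemigroup using (interchange)
  open import Algebra.Properties.Ring ring using (x[y-z]≈xy-xz; [y-z]x≈yx-zx)

  [x-y]+[z-w]≈[x+z]-[y+w] : ∀ x y z w → (x - y) + (z - w) ≈ (x + z) - (y + w)
  [x-y]+[z-w]≈[x+z]-[y+w] x y z w = trans (interchange x (- y) z (- w)) (+-congˡ (⁻¹-∙-comm y w))

  [x-y][z-w]≈[xz+yw]-[xw+yz] : ∀ x y z w → (x - y) * (z - w) ≈ (x * z + y * w) - (x * w + y * z)
  [x-y][z-w]≈[xz+yw]-[xw+yz] x y z w = begin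
    (x - y) * (z - w)                     ≈⟨ [y-z]x≈yx-zx (z - w) x y ⟩
    x * (z - w) - y * (z - w)             ≈⟨ +-cong (x[y-z]≈xy-xz x z w) (-‿cong (x[y-z]≈xy-xz y z w)) ⟩
    (x * z - x * w) - (y * z - y * w)     ≈⟨ +-congˡ (⁻¹-anti-homo‿- (y * z) (y * w)) ⟩
    (x * z - x * w) + (y * w - y * z)     ≈⟨ [x-y]+[z-w]≈[x+z]-[y+w] _ _ _ _ ⟩
    (x * z + y * w) - (x * w + y * z)     ∎

  ⟦_⟧ℤ : ℤ → Carrier
  ⟦ + n ⟧ℤ      = n × 1#
  ⟦ -[1+ n ] ⟧ℤ = - (suc n × 1#)

  ⟦m⊖n⟧ℤ≈m×1#-n×1# : ∀ m n → ⟦ m ⊖ n ⟧ℤ ≈ m × 1# - n × 1#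
  ⟦m⊖n⟧ℤ≈m×1#-n×1# zero    zero    = sym (-‿inverseʳ 0#)
  ⟦m⊖n⟧ℤ≈m×1#-n×1# zero    (suc n) = sym (+-identityˡ _)
  ⟦m⊖n⟧ℤ≈m×1#-n×1# (suc m) zero    = sym (trans (+-congˡ ε⁻¹≈ε) (+-identityʳ _))
  ⟦m⊖n⟧ℤ≈m×1#-n×1# (suc m) (suc n) = begin
    ⟦ suc m ⊖ suc n ⟧ℤ                      ≡⟨ ≡.cong ⟦_⟧ℤ (ℤ.[1+m]⊖[1+n]≡m⊖n m n) ⟩
    ⟦ m ⊖ n ⟧ℤ                              ≈⟨ ⟦m⊖n⟧ℤ≈m×1#-n×1# m n ⟩
    m × 1# - n × 1#                         ≈⟨ +-identityˡ _ ⟨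
    0# + (m × 1# - n × 1#)                  ≈⟨ +-congʳ (-‿inverseʳ 1#) ⟨
    (1# - 1#) + (m × 1# - n × 1#)           ≈⟨ [x-y]+[z-w]≈[x+z]-[y+w] _ _ _ _ ⟩
    (1# + m × 1#) - (1# + n × 1#)           ≈⟨ +-cong (1+× m 1#) (-‿cong (1+× n 1#)) ⟨
    suc m × 1# - suc n × 1#                 ∎

  ⟦_⟧ℤ-homomorphism : ℤ.+-*-rawRing -Raw-AlmostCommutative⟶ toAlmostCommutativeRing R
  ⟦_⟧ℤ-homomorphism = record
    { ⟦_⟧    = ⟦_⟧ℤ
    ; +-homo = +-homo
    ; *-homo = *-homo
    ; -‿homo = -‿homo
    ; 0-homo = refl
    ; 1-homo = refl
    }
    where
    +-homo : ∀ i j → ⟦ i ℤ.+ j ⟧ℤ ≈ ⟦ i ⟧ℤ + ⟦ j ⟧ℤ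
    +-homo i j with integer-as-difference i | integer-as-difference j
    ... | a , b , ≡.refl | c , d , ≡.refl = begin
      ⟦ (a ⊖ b) ℤ.+ (c ⊖ d) ⟧ℤ                   ≡⟨ ≡.cong ⟦_⟧ℤ (⊖-+-⊖ a b c d) ⟩
      ⟦ (a ℕ.+ c) ⊖ (b ℕ.+ d) ⟧ℤ                 ≈⟨ ⟦m⊖n⟧ℤ≈m×1#-n×1# (a ℕ.+ c) (b ℕ.+ d) ⟩
      (a ℕ.+ c) × 1# - (b ℕ.+ d) × 1#            ≈⟨ +-cong (×-homo-+ 1# a c) (-‿cong (×-homo-+ 1# b d)) ⟩
      (a × 1# + c × 1#) - (b × 1# + d × 1#)      ≈⟨ [x-y]+[z-w]≈[x+z]-[y+w] _ _ _ _ ⟨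
      (a × 1# - b × 1#) + (c × 1# - d × 1#)      ≈⟨ +-cong (⟦m⊖n⟧ℤ≈m×1#-n×1# a b) (⟦m⊖n⟧ℤ≈m×1#-n×1# c d) ⟨
      ⟦ a ⊖ b ⟧ℤ + ⟦ c ⊖ d ⟧ℤ                    ∎
    *-homo : ∀ i j → ⟦ i ℤ.* j ⟧ℤ ≈ ⟦ i ⟧ℤ * ⟦ j ⟧ℤ
    *-homo i j with integer-as-difference i | integer-as-difference j
    ... | a , b , ≡.refl | c , d , ≡.refl = begin
      ⟦ (a ⊖ b) ℤ.* (c ⊖ d) ⟧ℤ                   ≡⟨ ≡.cong ⟦_⟧ℤ (⊖-*-⊖ a b c d) ⟩
      ⟦ (a ℕ.* c ℕ.+ b ℕ.* d) ⊖ (a ℕ.* d ℕ.+ b ℕ.* c) ⟧ℤ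
        ≈⟨ ⟦m⊖n⟧ℤ≈m×1#-n×1# (a ℕ.* c ℕ.+ b ℕ.* d) (a ℕ.* d ℕ.+ b ℕ.* c) ⟩
      (a ℕ.* c ℕ.+ b ℕ.* d) × 1# - (a ℕ.* d ℕ.+ b ℕ.* c) × 1#
        ≈⟨ +-cong (×-homo-+ 1# (a ℕ.* c) (b ℕ.* d)) (-‿cong (×-homo-+ 1# (a ℕ.* d) (b ℕ.* c))) ⟩
      ((a ℕ.* c) × 1# + (b ℕ.* d) × 1#) - ((a ℕ.* d) × 1# + (b ℕ.* c) × 1#)
        ≈⟨ +-cong (+-cong (×1-homo-* a c) (×1-homo-* b d)) (-‿cong (+-cong (×1-homo-* a d) (×1-homo-* b c))) ⟩
      (a × 1# * c × 1# + b × 1# * d × 1#) - (a × 1# * d × 1# + b × 1# * c × 1#)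
        ≈⟨ [x-y][z-w]≈[xz+yw]-[xw+yz] _ _ _ _ ⟨
      (a × 1# - b × 1#) * (c × 1# - d × 1#)      ≈⟨ *-cong (⟦m⊖n⟧ℤ≈m×1#-n×1# a b) (⟦m⊖n⟧ℤ≈m×1#-n×1# c d) ⟨
      ⟦ a ⊖ b ⟧ℤ * ⟦ c ⊖ d ⟧ℤ                    ∎
    -‿homo : ∀ i → ⟦ ℤ.- i ⟧ℤ ≈ - ⟦ i ⟧ℤ
    -‿homo i with integer-as-difference i
    ... | a , b , ≡.refl = begin
      ⟦ ℤ.- (a ⊖ b) ⟧ℤ                           ≡⟨ ≡.cong ⟦_⟧ℤ (ℤ.⊖-swap b a) ⟨
      ⟦ b ⊖ a ⟧ℤ                                 ≈⟨ ⟦m⊖n⟧ℤ≈m×1#-n×1# b a ⟩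
      b × 1# - a × 1#                            ≈⟨ ⁻¹-anti-homo‿- (a × 1#) (b × 1#) ⟨
      - (a × 1# - b × 1#)                        ≈⟨ -‿cong (⟦m⊖n⟧ℤ≈m×1#-n×1# a b) ⟨
      - ⟦ a ⊖ b ⟧ℤ                               ∎

  ⟦_⟧ℤ-≟ : ∀ i j → Maybe (⟦ i ⟧ℤ ≈ ⟦ j ⟧ℤ)
  ⟦ i ⟧ℤ-≟ j with i ℤ.≟ j
  ... | yes ≡.refl = just refl
  ... | no _       = nothing

  open Algebra.Solver.Ring ℤ.+-*-rawRing (toAlmostCommutativeRing R) ⟦_⟧ℤ-homomorphism ⟦_⟧ℤ-≟ public
    using (solve; _:=_; con; _:+_; _:*_; _:-_)


module FieldProperties {c ℓ : Level} (F : Field c ℓ) where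
  open Field F
  open FieldNotation F
  open IntegerCoefficients commutativeRing
  open import Relation.Binary.Reasoning.Setoid setoid
  open import Algebra.Properties.CommutativeSemigroup +-commutativeSemigroup using (interchange)

  1≉0 : ¬ (1# ≈ 0#)
  1≉0 1≈0 = 0≉1 (sym 1≈0)

  x*y≉0⇒x≉0 : ∀ {x y} → ¬ (x * y ≈ 0#) → ¬ (x ≈ 0#)
  x*y≉0⇒x≉0 {x} {y} xy≉0 x≈0 = xy≉0 (trans (*-congʳ x≈0) (zeroˡ y))

  x*y≉0⇒y≉0 : ∀ {x y} → ¬ (x * y ≈ 0#) → ¬ (y ≈ 0#)
  x*y≉0⇒y≉0 {x} {y} xy≉0 = x*y≉0⇒x≉0 (λ yx≈0 → xy≉0 (trans (*-comm x y) yx≈0))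

  inverseˡ : ∀ x → ¬ (x ≈ 0#) → x ⁻¹ * x ≈ 1#
  inverseˡ x x≉0 = trans (*-comm (x ⁻¹) x) (inverseʳ x x≉0)

  x≉0∧y≉0⇒x*y≉0 : ∀ {x y} → ¬ (x ≈ 0#) → ¬ (y ≈ 0#) → ¬ (x * y ≈ 0#)
  x≉0∧y≉0⇒x*y≉0 {x} {y} x≉0 y≉0 xy≈0 = y≉0 (begin
    y                ≈⟨ *-identityˡ y ⟨
    1# * y           ≈⟨ *-congʳ (inverseˡ x x≉0) ⟨
    x ⁻¹ * x * y     ≈⟨ *-assoc (x ⁻¹) x y ⟩
    x ⁻¹ * (x * y)   ≈⟨ *-congˡ xy≈0 ⟩
    x ⁻¹ * 0#        ≈⟨ zeroʳ (x ⁻¹) ⟩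
    0#               ∎)

  ⁻¹-unique : ∀ {x y} → ¬ (x ≈ 0#) → x * y ≈ 1# → x ⁻¹ ≈ y
  ⁻¹-unique {x} {y} x≉0 xy≈1 = begin
    x ⁻¹              ≈⟨ *-identityʳ (x ⁻¹) ⟨
    x ⁻¹ * 1#         ≈⟨ *-congˡ xy≈1 ⟨
    x ⁻¹ * (x * y)    ≈⟨ *-assoc (x ⁻¹) x y ⟨
    x ⁻¹ * x * y      ≈⟨ *-congʳ (inverseˡ x x≉0) ⟩
    1# * y            ≈⟨ *-identityˡ y ⟩
    y                 ∎

  ⁻¹-factor : ∀ {x y z} → ¬ (z ≈ 0#) → x * y ≈ z → x ⁻¹ ≈ y * z ⁻¹
  ⁻¹-factor {x} {y} {z} z≉0 xy≈z = ⁻¹-unique x≉0 (begin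
    x * (y * z ⁻¹)    ≈⟨ *-assoc x y (z ⁻¹) ⟨
    x * y * z ⁻¹      ≈⟨ *-congʳ xy≈z ⟩
    z * z ⁻¹          ≈⟨ inverseʳ z z≉0 ⟩
    1#                ∎)
    where
    x≉0 : ¬ (x ≈ 0#)
    x≉0 = x*y≉0⇒x≉0 (λ xy≈0 → z≉0 (trans (sym xy≈z) xy≈0))

  poch≉0-≤ : ∀ {z p m n} → m ≤ n → ¬ (poch z p n ≈ 0#) → ¬ (poch z p m ≈ 0#)
  poch≉0-≤ {n = n} m≤n with ℕ.m≤n⇒m<n∨m≡n m≤n
  ... | inj₁ (s≤s m≤n-1) = λ pochₙ≉0 → poch≉0-≤ m≤n-1 (x*y≉0⇒x≉0 pochₙ≉0)
  ... | inj₂ ≡.refl     = λ pochₙ≉0 → pochₙ≉0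

  x*y÷[y*y*z]≈x*[y⁻¹*z⁻¹] : ∀ {x y z} → ¬ (y ≈ 0#) → ¬ (z ≈ 0#) → x * y ÷ (y * y * z) ≈ x * (y ⁻¹ * z ⁻¹)
  x*y÷[y*y*z]≈x*[y⁻¹*z⁻¹] {x} {y} {z} y≉0 z≉0 = begin
    x * y * (y * y * z) ⁻¹              ≈⟨ *-congˡ (⁻¹-unique (x≉0∧y≉0⇒x*y≉0 (x≉0∧y≉0⇒x*y≉0 y≉0 y≉0) z≉0) inverse) ⟩
    x * y * (y ⁻¹ * y ⁻¹ * z ⁻¹)        ≈⟨ solve 4 (λ x y y⁻¹ z⁻¹ → x :* y :* (y⁻¹ :* y⁻¹ :* z⁻¹) := x :* (y :* y⁻¹) :* (y⁻¹ :* z⁻¹)) refl x y (y ⁻¹) (z ⁻¹) ⟩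
    x * (y * y ⁻¹) * (y ⁻¹ * z ⁻¹)      ≈⟨ *-congʳ (trans (*-congˡ (inverseʳ y y≉0)) (*-identityʳ x)) ⟩
    x * (y ⁻¹ * z ⁻¹)                   ∎
    where
    inverse : y * y * z * (y ⁻¹ * y ⁻¹ * z ⁻¹) ≈ 1#
    inverse = begin
      y * y * z * (y ⁻¹ * y ⁻¹ * z ⁻¹)       ≈⟨ solve 4 (λ y z y⁻¹ z⁻¹ → y :* y :* z :* (y⁻¹ :* y⁻¹ :* z⁻¹) := (y :* y⁻¹) :* (y :* y⁻¹) :* (z :* z⁻¹)) refl y z (y ⁻¹) (z ⁻¹) ⟩
      (y * y ⁻¹) * (y * y ⁻¹) * (z * z ⁻¹)   ≈⟨ *-cong (*-cong (inverseʳ y y≉0) (inverseʳ y y≉0)) (inverseʳ z z≉0) ⟩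
      1# * 1# * 1#                           ≈⟨ trans (*-identityʳ _) (*-identityʳ 1#) ⟩
      1#                                     ∎

  x+y≈z⇒x≈z-y : ∀ {x y z} → x + y ≈ z → x ≈ z - y
  x+y≈z⇒x≈z-y {x} {y} {z} x+y≈z = trans (solve 2 (λ x y → x := (x :+ y) :- y) refl x y) (+-congʳ x+y≈z)

  *-distribˡ-sumTo : ∀ n x f → x * sumTo n f ≈ sumTo n (λ k → x * f k)
  *-distribˡ-sumTo zero    x f = zeroʳ x
  *-distribˡ-sumTo (suc n) x f = trans (distribˡ x (sumTo n f) (f n)) (+-congʳ (*-distribˡ-sumTo n x f))

  sumTo-+ : ∀ n f g → sumTo n f + sumTo n g ≈ sumTo n (λ k → f k + g k)
  sumTo-+ zero    f g = +-identityʳ 0#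
  sumTo-+ (suc n) f g = trans (interchange (sumTo n f) (f n) (sumTo n g) (g n)) (+-congʳ (sumTo-+ n f g))

  sumTo-telescope : ∀ n (f g : ℕ → Carrier) → (∀ k → suc k ≤ n → f k ≈ g k - g (suc k)) → sumTo n f ≈ g 0 - g n
  sumTo-telescope zero    f g steps = sym (-‿inverseʳ (g 0))
  sumTo-telescope (suc n) f g steps = begin
    sumTo n f + f n                         ≈⟨ +-cong (sumTo-telescope n f g (λ k k<n → steps k (ℕ.m≤n⇒m≤1+n k<n))) (steps n ℕ.≤-refl) ⟩
    (g 0 - g n) + (g n - g (suc n))         ≈⟨ solve 3 (λ a b c → (a :- b) :+ (b :- c) := a :- c) refl (g 0) (g n) (g (suc n)) ⟩
    g 0 - g (suc n)                         ∎

  quadratic-difference : ∀ {a b c d} → c * d ≈ a * b → ∀ u →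
    (1# - c * u) * (1# - d * u) - (1# - a * u) * (1# - b * u) ≈ (a + b - (c + d)) * u
  quadratic-difference {a} {b} {c} {d} cd≈ab u = begin
    (1# - c * u) * (1# - d * u) - (1# - a * u) * (1# - b * u)
      ≈⟨ solve 5 (λ a b c d u → (con (+ 1) :- c :* u) :* (con (+ 1) :- d :* u) :- (con (+ 1) :- a :* u) :* (con (+ 1) :- b :* u)
                              := (a :+ b :- (c :+ d)) :* u :+ (c :* d :- a :* b) :* (u :* u)) refl a b c d u ⟩
    (a + b - (c + d)) * u + (c * d - a * b) * (u * u)
      ≈⟨ +-congˡ (trans (*-congʳ (trans (+-congʳ cd≈ab) (-‿inverseʳ (a * b)))) (zeroˡ (u * u))) ⟩
    (a + b - (c + d)) * u + 0#
      ≈⟨ +-identityʳ _ ⟩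
    (a + b - (c + d)) * u ∎

module PochhammerRatio {c ℓ : Level} (F : Field c ℓ) (q A B C D X Y : Field.Carrier F) where
  open Field F
  open FieldNotation F
  open FieldProperties F
  open IntegerCoefficients commutativeRing
  open import Relation.Binary.Reasoning.Setoid setoid
  open import Algebra.Properties.Ring ring using (x[y-z]≈xy-xz)

  q² : Carrier
  q² = q * q

  numerator : ℕ → Carrier
  numerator k = poch A q k * poch B q k * poch X q² k

  denominator : ℕ → Carrier
  denominator k = poch C q k * poch D q k * poch Y q² k

  ratio : ℕ → Carrier
  ratio k = numerator k ÷ denominator k

  term₁ : ℕ → Carrier
  term₁ k = pow q k * (q ⁻¹) * numerator k ÷ (poch C q (suc k) * poch D q (suc k) * poch Y q² k)

  term₂ : ℕ → Carrier
  term₂ k = pow q² k * (poch A q (suc k) * poch B q (suc k) * poch X q² k) ÷ denominator (suc k)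

  denominator≉0-≤ : ∀ {m n} → m ≤ n → ¬ (denominator n ≈ 0#) → ¬ (denominator m ≈ 0#)
  denominator≉0-≤ {n = n} m≤n den≉0 = x≉0∧y≉0⇒x*y≉0 (x≉0∧y≉0⇒x*y≉0 (poch≉0-≤ m≤n Cₙ≉0) (poch≉0-≤ m≤n Dₙ≉0)) (poch≉0-≤ m≤n Yₙ≉0)
    where
    Cₙ≉0 : ¬ (poch C q n ≈ 0#)
    Cₙ≉0 = x*y≉0⇒x≉0 (x*y≉0⇒x≉0 den≉0)
    Dₙ≉0 : ¬ (poch D q n ≈ 0#)
    Dₙ≉0 = x*y≉0⇒y≉0 (x*y≉0⇒x≉0 den≉0)
    Yₙ≉0 : ¬ (poch Y q² n ≈ 0#)
    Yₙ≉0 = x*y≉0⇒y≉0 den≉0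

  ratio-zero : ratio 0 ≈ 1#
  ratio-zero = inverseʳ (1# * 1# * 1#) (x≉0∧y≉0⇒x*y≉0 (x≉0∧y≉0⇒x*y≉0 1≉0 1≉0) 1≉0)

  ratio-step : ∀ {E} → (∀ u → (1# - C * u) * (1# - D * u) - (1# - A * u) * (1# - B * u) ≈ E * (u * q ⁻¹)) →
               ∀ k → ¬ (denominator (suc k) ≈ 0#) →
               E * term₁ k + (X - Y) * term₂ k ≈ ratio k - ratio (suc k)
  ratio-step {E} quadratic k den≉0 = begin
    E * term₁ k + (X - Y) * term₂ k
      ≈⟨ +-cong (*-congˡ term₁≈) (*-congˡ term₂≈) ⟩
    E * (common * (u * q ⁻¹ * yy)) + (X - Y) * (common * (v * (aa * bb)))
      ≈⟨ solve 9 (λ E common u iq yy X Y v ab → E :* (common :* (u :* iq :* yy)) :+ (X :- Y) :* (common :* (v :* ab))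
                                             := common :* (E :* (u :* iq) :* yy :+ (X :- Y) :* v :* ab))
                 refl E common u (q ⁻¹) yy X Y v (aa * bb) ⟩
    common * (E * (u * q ⁻¹) * yy + (X - Y) * v * (aa * bb))
      ≈⟨ *-congˡ (+-congʳ (*-congʳ (sym (quadratic u)))) ⟩
    common * ((cc * dd - aa * bb) * yy + (X - Y) * v * (aa * bb))
      ≈⟨ *-congˡ (solve 5 (λ ab cd X Y v → (cd :- ab) :* (con (+ 1) :- Y :* v) :+ (X :- Y) :* v :* ab
                                          := cd :* (con (+ 1) :- Y :* v) :- ab :* (con (+ 1) :- X :* v))
                         refl (aa * bb) (cc * dd) X Y v) ⟩
    common * (cc * dd * yy - aa * bb * xx)
      ≈⟨ x[y-z]≈xy-xz common (cc * dd * yy) (aa * bb * xx) ⟩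
    common * (cc * dd * yy) - common * (aa * bb * xx)
      ≈⟨ +-cong ratio≈ (-‿cong ratio-suc≈) ⟨
    ratio k - ratio (suc k) ∎
    where
    u v aa bb cc dd xx yy common : Carrier
    u = pow q k
    v = pow q² k
    aa = 1# - A * u
    bb = 1# - B * u
    cc = 1# - C * u
    dd = 1# - D * u
    xx = 1# - X * v
    yy = 1# - Y * v
    common = numerator k * denominator (suc k) ⁻¹
    term₁≈ : term₁ k ≈ common * (u * q ⁻¹ * yy)
    term₁≈ = begin
      u * q ⁻¹ * numerator k * (poch C q (suc k) * poch D q (suc k) * poch Y q² k) ⁻¹
        ≈⟨ *-congˡ (⁻¹-factor den≉0 (*-assoc _ _ yy)) ⟩
      u * q ⁻¹ * numerator k * (yy * denominator (suc k) ⁻¹)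
        ≈⟨ solve 5 (λ u iq N yy iD → u :* iq :* N :* (yy :* iD) := N :* iD :* (u :* iq :* yy)) refl u (q ⁻¹) (numerator k) yy (denominator (suc k) ⁻¹) ⟩
      common * (u * q ⁻¹ * yy) ∎
    term₂≈ : term₂ k ≈ common * (v * (aa * bb))
    term₂≈ = solve 7 (λ v Aₖ aa Bₖ bb Xₖ iD → v :* ((Aₖ :* aa) :* (Bₖ :* bb) :* Xₖ) :* iD := Aₖ :* Bₖ :* Xₖ :* iD :* (v :* (aa :* bb)))
               refl v (poch A q k) aa (poch B q k) bb (poch X q² k) (denominator (suc k) ⁻¹)
    ratio≈ : ratio k ≈ common * (cc * dd * yy)
    ratio≈ = begin
      numerator k * denominator k ⁻¹
        ≈⟨ *-congˡ (⁻¹-factor den≉0 (solve 6 (λ Cₖ cc Dₖ dd Yₖ yy → Cₖ :* Dₖ :* Yₖ :* (cc :* dd :* yy) := (Cₖ :* cc) :* (Dₖ :* dd) :* (Yₖ :* yy))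
                                          refl (poch C q k) cc (poch D q k) dd (poch Y q² k) yy)) ⟩
      numerator k * (cc * dd * yy * denominator (suc k) ⁻¹)
        ≈⟨ solve 3 (λ N P iD → N :* (P :* iD) := N :* iD :* P) refl (numerator k) (cc * dd * yy) (denominator (suc k) ⁻¹) ⟩
      common * (cc * dd * yy) ∎
    ratio-suc≈ : ratio (suc k) ≈ common * (aa * bb * xx)
    ratio-suc≈ = solve 7 (λ Aₖ aa Bₖ bb Xₖ xx iD → (Aₖ :* aa) :* (Bₖ :* bb) :* (Xₖ :* xx) :* iD := Aₖ :* Bₖ :* Xₖ :* iD :* (aa :* bb :* xx))
                   refl (poch A q k) aa (poch B q k) bb (poch X q² k) xx (denominator (suc k) ⁻¹)

  summation-formula : ∀ {E} → (∀ u → (1# - C * u) * (1# - D * u) - (1# - A * u) * (1# - B * u) ≈ E * (u * q ⁻¹)) →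
                      ∀ n → ¬ (denominator n ≈ 0#) →
                      E * sumTo n term₁ ≈ 1# - ratio n - (X - Y) * sumTo n term₂
  summation-formula {E} quadratic n den≉0 = x+y≈z⇒x≈z-y (begin
    E * sumTo n term₁ + (X - Y) * sumTo n term₂
      ≈⟨ +-cong (*-distribˡ-sumTo n E term₁) (*-distribˡ-sumTo n (X - Y) term₂) ⟩
    sumTo n (λ k → E * term₁ k) + sumTo n (λ k → (X - Y) * term₂ k)
      ≈⟨ sumTo-+ n _ _ ⟩
    sumTo n (λ k → E * term₁ k + (X - Y) * term₂ k)
      ≈⟨ sumTo-telescope n _ ratio (λ k k<n → ratio-step quadratic k (denominator≉0-≤ k<n den≉0)) ⟩
    ratio 0 - ratio n
      ≈⟨ +-congʳ ratio-zero ⟩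
    1# - ratio n ∎)

module Parameters {c ℓ : Level} (F : Field c ℓ) (q a₁ a₂ a₃ a₄ : Field.Carrier F) where
  open Field F
  open FieldNotation F
  open FieldProperties F
  open IntegerCoefficients commutativeRing
  open import Relation.Binary.Reasoning.Setoid setoid

  K E₀ A B C D : Carrier
  K  = a₁ * a₂ * a₃ * a₄
  E₀ = (a₁ - a₂ * a₄ ÷ a₃) * (a₁ - a₂ * a₃ ÷ a₄)
  A  = a₁ * a₁ ÷ q
  B  = a₂ * a₂ ÷ q
  C  = K ÷ (a₃ * a₃ * q)
  D  = K ÷ (a₄ * a₄ * q)

  module _ (q≉0 : ¬ (q ≈ 0#)) (a₃≉0 : ¬ (a₃ ≈ 0#)) (a₄≉0 : ¬ (a₄ ≈ 0#)) where

    a₃a₃⁻¹a₄a₄⁻¹≈1 : a₃ * a₃ ⁻¹ * (a₄ * a₄ ⁻¹) ≈ 1#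
    a₃a₃⁻¹a₄a₄⁻¹≈1 = trans (*-cong (inverseʳ a₃ a₃≉0) (inverseʳ a₄ a₄≉0)) (*-identityʳ 1#)

    C≈ : C ≈ a₁ * a₂ * a₄ * (a₃ ⁻¹ * q ⁻¹)
    C≈ = trans (*-congʳ (solve 4 (λ a₁ a₂ a₃ a₄ → a₁ :* a₂ :* a₃ :* a₄ := a₁ :* a₂ :* a₄ :* a₃) refl a₁ a₂ a₃ a₄))
               (x*y÷[y*y*z]≈x*[y⁻¹*z⁻¹] a₃≉0 q≉0)

    D≈ : D ≈ a₁ * a₂ * a₃ * (a₄ ⁻¹ * q ⁻¹)
    D≈ = x*y÷[y*y*z]≈x*[y⁻¹*z⁻¹] a₄≉0 q≉0

    CD≈AB : C * D ≈ A * B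
    CD≈AB = begin
      C * D
        ≈⟨ *-cong C≈ D≈ ⟩
      a₁ * a₂ * a₄ * (a₃ ⁻¹ * q ⁻¹) * (a₁ * a₂ * a₃ * (a₄ ⁻¹ * q ⁻¹))
        ≈⟨ solve 7 (λ a₁ a₂ a₃ a₄ a₃⁻¹ a₄⁻¹ q⁻¹ → a₁ :* a₂ :* a₄ :* (a₃⁻¹ :* q⁻¹) :* (a₁ :* a₂ :* a₃ :* (a₄⁻¹ :* q⁻¹))
                                              := a₁ :* a₁ :* q⁻¹ :* (a₂ :* a₂ :* q⁻¹) :* (a₃ :* a₃⁻¹ :* (a₄ :* a₄⁻¹)))
                   refl a₁ a₂ a₃ a₄ (a₃ ⁻¹) (a₄ ⁻¹) (q ⁻¹) ⟩
      A * B * (a₃ * a₃ ⁻¹ * (a₄ * a₄ ⁻¹))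
        ≈⟨ trans (*-congˡ a₃a₃⁻¹a₄a₄⁻¹≈1) (*-identityʳ (A * B)) ⟩
      A * B ∎

    A+B-[C+D]≈E₀*q⁻¹ : A + B - (C + D) ≈ E₀ * q ⁻¹
    A+B-[C+D]≈E₀*q⁻¹ = begin
      A + B - (C + D)
        ≈⟨ +-congˡ (-‿cong (+-cong C≈ D≈)) ⟩
      A + B - (a₁ * a₂ * a₄ * (a₃ ⁻¹ * q ⁻¹) + a₁ * a₂ * a₃ * (a₄ ⁻¹ * q ⁻¹))
        ≈⟨ solve 7 (λ a₁ a₂ a₃ a₄ a₃⁻¹ a₄⁻¹ q⁻¹ →
                      a₁ :* a₁ :* q⁻¹ :+ a₂ :* a₂ :* q⁻¹ :- (a₁ :* a₂ :* a₄ :* (a₃⁻¹ :* q⁻¹) :+ a₁ :* a₂ :* a₃ :* (a₄⁻¹ :* q⁻¹))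
                   := (a₁ :- a₂ :* a₄ :* a₃⁻¹) :* (a₁ :- a₂ :* a₃ :* a₄⁻¹) :* q⁻¹
                        :+ a₂ :* a₂ :* q⁻¹ :* (con (+ 1) :- a₃ :* a₃⁻¹ :* (a₄ :* a₄⁻¹)))
                   refl a₁ a₂ a₃ a₄ (a₃ ⁻¹) (a₄ ⁻¹) (q ⁻¹) ⟩
      E₀ * q ⁻¹ + B * (1# - a₃ * a₃ ⁻¹ * (a₄ * a₄ ⁻¹))
        ≈⟨ +-congˡ (trans (*-congˡ (trans (+-congˡ (-‿cong a₃a₃⁻¹a₄a₄⁻¹≈1)) (-‿inverseʳ 1#))) (zeroʳ B)) ⟩
      E₀ * q ⁻¹ + 0#
        ≈⟨ +-identityʳ _ ⟩
      E₀ * q ⁻¹ ∎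

    quadratic-difference≈E₀*u/q : ∀ u → (1# - C * u) * (1# - D * u) - (1# - A * u) * (1# - B * u) ≈ E₀ * (u * q ⁻¹)
    quadratic-difference≈E₀*u/q u = begin
      (1# - C * u) * (1# - D * u) - (1# - A * u) * (1# - B * u) ≈⟨ quadratic-difference CD≈AB u ⟩
      (A + B - (C + D)) * u                                     ≈⟨ *-congʳ A+B-[C+D]≈E₀*q⁻¹ ⟩
      E₀ * q ⁻¹ * u                                             ≈⟨ solve 3 (λ E q⁻¹ u → E :* q⁻¹ :* u := E :* (u :* q⁻¹)) refl E₀ (q ⁻¹) u ⟩
      E₀ * (u * q ⁻¹)                                           ∎

theorem3p10 : {c ℓ : Level} (F : Field c ℓ) →
  let open Field F
      open FieldNotation F
  in (q a₁ a₂ a₃ a₄ x₁ x₂ x₃ x₄ : Carrier) (n : ℕ) →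
     ¬ (q ≈ 0#) →
     ¬ (a₁ ≈ 0#) → ¬ (a₂ ≈ 0#) → ¬ (a₃ ≈ 0#) → ¬ (a₄ ≈ 0#) →
     ¬ (x₁ ≈ 0#) → ¬ (x₂ ≈ 0#) → ¬ (x₃ ≈ 0#) → ¬ (x₄ ≈ 0#) →
     let K  = a₁ * a₂ * a₃ * a₄
         E₀ = (a₁ - a₂ * a₄ ÷ a₃) * (a₁ - a₂ * a₃ ÷ a₄)
         A  = a₁ * a₁ ÷ q
         B  = a₂ * a₂ ÷ q
         C  = K ÷ (a₃ * a₃ * q)
         D  = K ÷ (a₄ * a₄ * q)
         X  = x₁ * x₁
         Y  = x₁ * x₃ * x₄ ÷ x₂
         q² = q * q
     in ¬ (poch C q n ≈ 0#) → ¬ (poch D q n ≈ 0#) → ¬ (poch Y q² n ≈ 0#) →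
        E₀ * sumTo n (λ k → pow q k * (q ⁻¹)
               * (poch A q k * poch B q k * poch X q² k)
               ÷ (poch C q (suc k) * poch D q (suc k) * poch Y q² k))
        ≈ 1# - (poch A q n * poch B q n * poch X q² n)
               ÷ (poch C q n * poch D q n * poch Y q² n)
             - x₁ * (x₁ - x₃ * x₄ ÷ x₂)
               * sumTo n (λ k → pow q² k
                   * (poch A q (suc k) * poch B q (suc k) * poch X q² k)
                   ÷ (poch C q (suc k) * poch D q (suc k) * poch Y q² (suc k)))
theorem3p10 F q a₁ a₂ a₃ a₄ x₁ x₂ x₃ x₄ n q≉0 _ _ a₃≉0 a₄≉0 _ _ _ _ Cₙ≉0 Dₙ≉0 Yₙ≉0 = begin
  E₀ * sumTo n term₁                                       ≈⟨ summation-formula (quadratic-difference≈E₀*u/q q≉0 a₃≉0 a₄≉0) n denominator≉0 ⟩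
  1# - ratio n - (x₁ * x₁ - x₁ * x₃ * x₄ ÷ x₂) * sumTo n term₂ ≈⟨ +-congˡ (-‿cong (*-congʳ factor)) ⟨
  1# - ratio n - x₁ * (x₁ - x₃ * x₄ ÷ x₂) * sumTo n term₂ ∎
  where
  open Field F
  open FieldNotation F
  open FieldProperties F
  open IntegerCoefficients commutativeRing
  open Parameters F q a₁ a₂ a₃ a₄
  open PochhammerRatio F q A B C D (x₁ * x₁) (x₁ * x₃ * x₄ ÷ x₂)
  open import Relation.Binary.Reasoning.Setoid setoid
  denominator≉0 : ¬ (denominator n ≈ 0#)
  denominator≉0 = x≉0∧y≉0⇒x*y≉0 (x≉0∧y≉0⇒x*y≉0 Cₙ≉0 Dₙ≉0) Yₙ≉0
  factor : x₁ * (x₁ - x₃ * x₄ ÷ x₂) ≈ x₁ * x₁ - x₁ * x₃ * x₄ ÷ x₂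
  factor = solve 4 (λ x₁ x₃ x₄ x₂⁻¹ → x₁ :* (x₁ :- x₃ :* x₄ :* x₂⁻¹) := x₁ :* x₁ :- x₁ :* x₃ :* x₄ :* x₂⁻¹) refl x₁ x₃ x₄ (x₂ ⁻¹)
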